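{- Let $G$ be a graph and $v\in V(G)$ such that $L(v)\neq\emptyset$. Let $G'=G\setminus(\{v\}\cup L(v))$ and let $S'$ be a Grundy total dominating sequence of $G'$. Then for any $\ell\in L(v)$, the sequence $(\ell)\oplus S'\oplus(v)$ is a Grundy total dominating sequence of $G$, and $\gamma_{\rm gr}^t(G)=\gamma_{\rm gr}^t(G')+2$.
   Context: All graphs are finite and simple; $N(x)$ is the open neighborhood of $x$. A leaf is a vertex of degree $1$; $L(v)$ is the set of leaves adjacent to $v$. $G\setminus X$ is the subgraph induced by $V(G)\setminus X$. A sequence $(v_1,\ldots,v_k)$ of distinct vertices is legal if for every $i\in\{1,\ldots,k\}$, $N(v_i)\setminus\bigcup_{j=1}^{i-1}N(v_j)\neq\emptyset$ (the empty sequence is legal). $\gamma_{\rm gr}^t(G)$ is the maximum length of a legal sequence (defined also for graphs with isolated vertices; $0$ for graphs without edges), and a legal sequence of that length is a Grundy total dominating sequence. For sequences with disjoint vertex sets, $(a_1,\ldots,a_n)\oplus(b_1,\ldots,b_m)=(a_1,\ldots,a_n,b_1,\ldots,b_m)$. -}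

module Defs where

open import Data.Nat using (ℕ; _≤_)
open import Data.Fin using (Fin)
open import Data.Bool using (Bool; true; false)
open import Data.List using (List; []; _∷_; length)
open import Data.List.Relation.Unary.All using (All)
open import Data.List.Membership.Propositional using (_∉_)
open import Data.Product using (Σ; ∃; _×_; _,_)
open import Data.Unit using (⊤)
open import Relation.Nullary using (¬_)
open import Relation.Binary.PropositionalEquality using (_≡_)

record Graph (n : ℕ) : Set where
  field
    adj   : Fin n → Fin n → Bool
    sym   : ∀ x y → adj x y ≡ adj y x
    irrefl : ∀ x → adj x x ≡ false
open Graph public

module _ {n : ℕ} (G : Graph n) where

  Adj : Fin n → Fin n → Set
  Adj x y = adj G x y ≡ true

  IsLeaf : Fin n → Set
  IsLeaf x = Σ (Fin n) λ y → Adj x y × (∀ z → Adj x z → z ≡ y)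

  InL : Fin n → Fin n → Set
  InL v ℓ = IsLeaf ℓ × Adj v ℓ

  Rest : Fin n → Fin n → Set
  Rest v x = ¬ (x ≡ v) × ¬ InL v x

  Full : Fin n → Set
  Full _ = ⊤

  -- Legal sequences in the induced subgraph G[W] (vertex set W).
  -- 'prev' is the list of previously chosen vertices (in reverse order);
  -- the new vertex x must be in W, distinct from previous ones, and have a
  -- neighbour y in G[W] not adjacent to any previously chosen vertex.
  LegalFrom : (W : Fin n → Set) → List (Fin n) → List (Fin n) → Set
  LegalFrom W prev [] = ⊤
  LegalFrom W prev (x ∷ s) =
    W x × x ∉ prev
    × (Σ (Fin n) λ y → W y × Adj x y × All (λ u → ¬ Adj u y) prev)
    × LegalFrom W (x ∷ prev) s

  Legal : (Fin n → Set) → List (Fin n) → Set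
  Legal W s = LegalFrom W [] s

  IsGrundyTDS : (Fin n → Set) → List (Fin n) → Set
  IsGrundyTDS W s = Legal W s × (∀ t → Legal W t → length t ≤ length s)

  GrundyTotalNumber : (Fin n → Set) → ℕ → Set
  GrundyTotalNumber W k =
    (Σ (List (Fin n)) λ s → Legal W s × length s ≡ k)
    × (∀ t → Legal W t → length t ≤ k)

-- Every vertex x of a legal sequence has a footprint: a neighbour y seen by no
-- earlier vertex. A legal sequence of G projects onto one of
-- G' = G ∖ ({v} ∪ L(v)) by deleting v itself and the (at most one) vertex whose
-- footprint is v: for every other vertex both x and y differ from v, so neither
-- is a leaf at v. Hence γ(G) ≤ γ(G') + 2. Conversely a leaf ℓ ∈ L(v) first
-- footprints v, then S' runs unchanged since ℓ sees only v, and finally v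
-- footprints ℓ, which no vertex of G' sees.
module Submission where

open import Defs
open import Data.Nat using (ℕ; zero; suc; _+_; _≤_; z≤n; s≤s)
open import Data.Nat.Properties using (+-suc; +-assoc; ≤-trans; ≤-reflexive; +-monoˡ-≤)
open import Data.Fin using (Fin; _≟_)
open import Data.List using (List; []; _∷_; _++_; _ʳ++_; length)
open import Data.List.Properties using (length-++)
open import Data.List.Relation.Unary.All as All using (All; []; _∷_)
open import Data.List.Relation.Unary.All.Properties using (++⁺; All¬⇒¬Any; anti-mono)
open import Data.List.Relation.Unary.Any using (Any; here; there)
open import Data.List.Membership.Propositional using (_∈_; _∉_)
open import Data.List.Membership.Propositional.Properties using (∈-++⁻)
open import Data.List.Relation.Binary.Subset.Propositional using (_⊆_)
open import Data.List.Relation.Binary.Subset.Propositional.Properties using (∷⁺ʳ)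
open import Data.Product using (Σ; ∃; _×_; _,_; proj₁; proj₂)
open import Data.Sum using (inj₁; inj₂)
open import Data.Unit using (⊤; tt)
open import Data.Empty using (⊥-elim)
open import Relation.Nullary using (¬_; yes; no)
open import Relation.Binary.PropositionalEquality as ≡ using (_≡_; refl; trans; cong)

ʳ++⁺ : ∀ {a p} {A : Set a} {P : A → Set p} {xs ys : List A}
     → All P xs → All P ys → All P (xs ʳ++ ys)
ʳ++⁺ []         pys = pys
ʳ++⁺ (px ∷ pxs) pys = ʳ++⁺ pxs (px ∷ pys)

module _ {n : ℕ} (G : Graph n) where

  Adj-sym : ∀ {x y} → Adj G x y → Adj G y x
  Adj-sym {x} {y} p = trans (Graph.sym G y x) p

  Adj-irrefl : ∀ {x} → ¬ Adj G x x
  Adj-irrefl {x} p with trans (≡.sym p) (Graph.irrefl G x)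
  ... | ()

  IsLeaf-unique : ∀ {x y z} → IsLeaf G x → Adj G x y → Adj G x z → y ≡ z
  IsLeaf-unique (w , _ , only-w) p q = trans (only-w _ p) (≡.sym (only-w _ q))

  legalFrom-++ : ∀ {W} prev s t → LegalFrom G W prev s → LegalFrom G W (s ʳ++ prev) t
               → LegalFrom G W prev (s ++ t)
  legalFrom-++ prev []      t _                  lt = lt
  legalFrom-++ prev (x ∷ s) t (wx , x∉ , fp , ls) lt = wx , x∉ , fp , legalFrom-++ (x ∷ prev) s t ls lt

  legalFrom-⊆ : ∀ {W} prev s → LegalFrom G W prev s → All W s
  legalFrom-⊆ prev []      _                 = []
  legalFrom-⊆ prev (x ∷ s) (wx , _ , _ , ls) = wx ∷ legalFrom-⊆ (x ∷ prev) s ls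

  legalFrom-enlarge : ∀ {W W' : Fin n → Set} → (∀ {x} → W x → W' x)
    → ∀ {extra} → All (λ u → ¬ W u × (∀ y → W y → ¬ Adj G u y)) extra
    → ∀ prev s → LegalFrom G W prev s → LegalFrom G W' (prev ++ extra) s
  legalFrom-enlarge W⊆W' outside prev [] _ = tt
  legalFrom-enlarge W⊆W' {extra} outside prev (x ∷ s) (wx , x∉prev , (y , wy , xy , new) , ls) =
      W⊆W' wx
    , x∉prev++extra
    , (y , W⊆W' wy , xy , ++⁺ new (All.map (λ out → proj₂ out y wy) outside))
    , legalFrom-enlarge W⊆W' outside (x ∷ prev) s ls
    where
    x∉prev++extra : x ∉ prev ++ extra
    x∉prev++extra x∈ with ∈-++⁻ prev x∈
    ... | inj₁ x∈prev  = x∉prev x∈prev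
    ... | inj₂ x∈extra = proj₁ (All.lookup outside x∈extra) wx

module _ {n : ℕ} (G : Graph n) (v : Fin n) where

  Rest-of-Adj : ∀ {x y} → Adj G x y → ¬ x ≡ v → ¬ y ≡ v → Rest G v x
  Rest-of-Adj xy x≢v y≢v = x≢v , λ (leaf , vx) → y≢v (IsLeaf-unique G leaf xy (Adj-sym G vx))

  Dominated : List (Fin n) → Set
  Dominated prev = Any (λ u → Adj G u v) prev

  -- `Credit c P`: P is required only once the credit c is used up.
  Credit : ℕ → Set → Set
  Credit zero    P = P
  Credit (suc _) P = ⊤

  Credit-of : ∀ c {P : Set} → P → Credit c P
  Credit-of zero    p = p
  Credit-of (suc _) _ = tt

  Credit-map : ∀ c {P Q : Set} → (P → Q) → Credit c P → Credit c Q
  Credit-map zero    f p = f p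
  Credit-map (suc _) _ _ = tt

  Credit-spend : ∀ c {P : Set} → ¬ P → Credit c P → ∃ λ c' → c ≡ suc c'
  Credit-spend zero    ¬p p = ⊥-elim (¬p p)
  Credit-spend (suc c) _  _ = c , refl

  -- The credits a and b pay for deleting v and the vertex footprinting v.
  project : ∀ a b {prev prev'} t → prev' ⊆ prev
          → Credit a (v ∈ prev) → Credit b (Dominated prev)
          → LegalFrom G (Full G) prev t
          → Σ (List (Fin n)) λ t' → LegalFrom G (Rest G v) prev' t' × length t ≤ length t' + a + b
  project a b [] _ _ _ _ = [] , tt , z≤n
  project a b (x ∷ s) prev'⊆ ca cb (_ , x∉ , (y , _ , xy , new) , ls) with y ≟ v | x ≟ v
  ... | yes refl | _ with Credit-spend b (All¬⇒¬Any new) cb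
  ...   | b' , refl with project a b' s (λ m → there (prev'⊆ m)) (Credit-map a there ca) (Credit-of b' (here xy)) ls
  ...     | t' , lt' , len = t' , lt' , ≤-trans (s≤s len) (≤-reflexive (≡.sym (+-suc _ b')))
  project a b (x ∷ s) prev'⊆ ca cb (_ , x∉ , (y , _ , xy , new) , ls) | no y≢v | yes refl with Credit-spend a x∉ ca
  ...   | a' , refl with project a' b s (λ m → there (prev'⊆ m)) (Credit-of a' (here refl)) (Credit-map b there cb) ls
  ...     | t' , lt' , len = t' , lt' , ≤-trans (s≤s len) (≤-reflexive (cong (_+ b) (≡.sym (+-suc _ a'))))
  project a b (x ∷ s) prev'⊆ ca cb (_ , x∉ , (y , _ , xy , new) , ls) | no y≢v | no x≢v
    with project a b s (∷⁺ʳ x prev'⊆) (Credit-map a there ca) (Credit-map b there cb) ls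
  ... | t' , lt' , len =
      x ∷ t'
    , ( Rest-of-Adj xy x≢v y≢v
      , (λ m → x∉ (prev'⊆ m))
      , (y , Rest-of-Adj (Adj-sym G xy) y≢v x≢v , xy , anti-mono prev'⊆ new)
      , lt')
    , s≤s len

  legal-length-bound : ∀ k → (∀ t → Legal G (Rest G v) t → length t ≤ k)
                     → ∀ t → Legal G (Full G) t → length t ≤ k + 2
  legal-length-bound k max t lt with project 1 1 t (λ ()) tt tt lt
  ... | t' , lt' , len = ≤-trans len (≤-trans (≤-reflexive (+-assoc (length t') 1 1)) (+-monoˡ-≤ 2 (max t' lt')))

module _ {n : ℕ} (G : Graph n) (v ℓ : Fin n) (ℓ∈L : InL G v ℓ) where

  leaf-Adj : ∀ {z} → Adj G ℓ z → z ≡ v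
  leaf-Adj ℓz = IsLeaf-unique G (proj₁ ℓ∈L) ℓz (Adj-sym G (proj₂ ℓ∈L))

  Rest-¬Adj-leaf : ∀ {u} → Rest G v u → ¬ Adj G u ℓ
  Rest-¬Adj-leaf (u≢v , _) uℓ = u≢v (leaf-Adj (Adj-sym G uℓ))

  leaf-isolated-from-Rest : ¬ Rest G v ℓ × (∀ y → Rest G v y → ¬ Adj G ℓ y)
  leaf-isolated-from-Rest = (λ (_ , ¬ℓ∈L) → ¬ℓ∈L ℓ∈L) , λ y ry ℓy → Rest-¬Adj-leaf ry (Adj-sym G ℓy)

  wrap-legal : ∀ s → Legal G (Rest G v) s → Legal G (Full G) (ℓ ∷ (s ++ (v ∷ [])))
  wrap-legal s ls =
      tt , (λ ()) , (v , tt , Adj-sym G vℓ , [])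
    , legalFrom-++ G (ℓ ∷ []) s (v ∷ [])
        (legalFrom-enlarge G (λ _ → tt) (leaf-isolated-from-Rest ∷ []) [] s ls)
        ( tt
        , All¬⇒¬Any (ʳ++⁺ (All.map (λ (u≢v , _) v≡u → u≢v (≡.sym v≡u)) s⊆Rest) (v≢ℓ ∷ []))
        , (ℓ , tt , vℓ , ʳ++⁺ (All.map Rest-¬Adj-leaf s⊆Rest) (Adj-irrefl G ∷ []))
        , tt)
    where
    vℓ : Adj G v ℓ
    vℓ = proj₂ ℓ∈L
    v≢ℓ : ¬ v ≡ ℓ
    v≢ℓ refl = Adj-irrefl G vℓ
    s⊆Rest : All (Rest G v) s
    s⊆Rest = legalFrom-⊆ G [] s ls

  length-wrap : ∀ s → length (ℓ ∷ (s ++ (v ∷ []))) ≡ length s + 2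
  length-wrap s = trans (cong suc (length-++ s)) (≡.sym (+-suc (length s) 1))

proposition3p7 : (n : ℕ) (G : Graph n) (v : Fin n)
    → Σ (Fin n) (InL G v)
    → (S' : List (Fin n)) → IsGrundyTDS G (Rest G v) S'
    → ((ℓ : Fin n) → InL G v ℓ → IsGrundyTDS G (Full G) (ℓ ∷ (S' ++ (v ∷ []))))
      × ((k : ℕ) → GrundyTotalNumber G (Rest G v) k → GrundyTotalNumber G (Full G) (k + 2))
proposition3p7 n G v (ℓ₀ , ℓ₀∈L) S' (S'-legal , S'-max) =
    (λ ℓ ℓ∈L →
        wrap-legal G v ℓ ℓ∈L S' S'-legal
      , λ t lt → ≤-trans (legal-length-bound G v (length S') S'-max t lt)
                         (≤-reflexive (≡.sym (length-wrap G v ℓ ℓ∈L S'))))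
  , λ k ((s , s-legal , s-length) , k-max) →
        ( ℓ₀ ∷ (s ++ (v ∷ []))
        , wrap-legal G v ℓ₀ ℓ₀∈L s s-legal
        , trans (length-wrap G v ℓ₀ ℓ₀∈L s) (cong (_+ 2) s-length))
      , legal-length-bound G v k k-max
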